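{- Let $\mathcal X=\{0,1\}^n$ with the Hamming distance $d$, $n\ge1$, and let $\lambda(x,y)=\frac12\sum_{u\in\mathcal X}|d(x,u)-d(y,u)|$. Then the average value of $\lambda$ over $\mathcal X\times\mathcal X$ equals $$\frac1{2^{2n}}\sum_{x,y\in\mathcal X}\lambda(x,y)=\Lambda_n:=\frac{n}{2^{n+1}}\binom{2n}{n}.$$ Equivalently, $\sum_{w=1}^n\binom nw 2^{n-w}w\binom{w-1}{\lceil w/2\rceil-1}=\frac n2\binom{2n}{n}$.
   Context: $d$ is the Hamming distance on $\{0,1\}^n$. -}

module Defs where

open import Data.Bool using (Bool; true; false)
open import Data.Nat using (ℕ; zero; suc; _+_; _^_; _∸_)
open import Data.Nat.Combinatorics using (_C_)
open import Data.Vec using (Vec; []; _∷_)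
open import Data.List using (List; []; _∷_; map; concatMap)
open import Data.Nat.ListAction using (sum)
open import Data.Rational using (ℚ; _*_)
import Data.Rational as ℚ
open import Data.Integer using (+_)

Cube : ℕ → Set
Cube n = Vec Bool n

allCube : (n : ℕ) → List (Cube n)
allCube zero = [] ∷ []
allCube (suc n) = concatMap (λ v → (false ∷ v) ∷ (true ∷ v) ∷ []) (allCube n)

natℚ : ℕ → ℚ
natℚ k = (+ k) ℚ./ 1

ham : {n : ℕ} → Cube n → Cube n → ℕ
ham [] [] = 0
ham (false ∷ x) (false ∷ y) = ham x y
ham (true ∷ x) (true ∷ y) = ham x y
ham (false ∷ x) (true ∷ y) = suc (ham x y)
ham (true ∷ x) (false ∷ y) = suc (ham x y)

absDiff : ℕ → ℕ → ℕ
absDiff a b = (a ∸ b) + (b ∸ a)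

lam : {n : ℕ} → Cube n → Cube n → ℚ
lam {n} x y = ℚ.½ * natℚ (sum (map (λ u → absDiff (ham x u) (ham y u)) (allCube n)))

sumℚ : List ℚ → ℚ
sumℚ [] = ℚ.0ℚ
sumℚ (q ∷ qs) = q ℚ.+ sumℚ qs

half^ : ℕ → ℚ
half^ zero = ℚ.1ℚ
half^ (suc k) = ℚ.½ * half^ k

avgLam : (n : ℕ) → ℚ
avgLam n = half^ (n + n) * sumℚ (concatMap (λ x → map (λ y → lam x y) (allCube n)) (allCube n))

Λ : ℕ → ℚ
Λ n = (natℚ n * half^ (suc n)) * natℚ ((n + n) C n)

module Submission where

-- The whole proof is about the triple sum  ∑_{x,y,u} F(d(x,u), d(y,u))  of a
-- kernel F of two distances.  Splitting off one coordinate of x, y, u shows that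
-- this sum over {0,1}^(n+1) equals the sum over {0,1}^n of the kernel Φ F, where
-- Φ F (a,b) adds up F at the eight ways one coordinate can move (a,b); hence the
-- triple sum over {0,1}^n is (Φ^n F)(0,0).  The operator Φ is additive, commutes
-- with shifting either argument, and preserves symmetry and invariance under
-- (a,b) ↦ (a+1,b+1).  With  |a-(b+1)| + |(a+1)-b| = 2|a-b| + 2[a=b]  this gives
--   A(n+1) = 8 A(n) + 4 E(n),   where  A(n) = (Φ^n |·-·|)(0,0),  E(n) = (Φ^n [·=·])(0,0),
-- and the coincidence counts satisfy the Pascal-type recurrence solved by
-- E n k 0 = 2^n C(2n, n+k).  Binomial identities then yield
-- ∑_{x,y,u} |d(x,u) - d(y,u)| = n 2^n C(2n,n), and the theorem is the translation
-- of this identity of naturals into the rational statement.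

open import Defs
open import Data.Bool using (Bool; true; false)
open import Data.Nat using (ℕ; zero; suc; _+_; _*_; _^_; _≥_; z≤n; s≤s)
open import Data.Nat.Properties
open import Data.Vec using (_∷_)
open import Data.List using (List; []; _∷_; _++_; map; concatMap)
open import Data.List.Properties using (map-cong)
open import Data.Nat.ListAction using (sum)
open import Data.Nat.Combinatorics using (_C_; nCk+nC[k+1]≡[n+1]C[k+1]; nCk≡nC[n∸k]; nC1≡n; k>n⇒nCk≡0)
open import Algebra.Bundles using (CommutativeMonoid)
import Algebra.Properties.CommutativeSemigroup
open Algebra.Properties.CommutativeSemigroup +-commutativeSemigroup using (interchange)
open import Relation.Binary.PropositionalEquality
open import Data.Nat.Solver using (module +-*-Solver)
open +-*-Solver using (solve; _:+_; _:*_; _:=_; con)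
import Data.Integer as ℤ
import Data.Integer.Properties as ℤP
open import Data.Rational as ℚ using (ℚ; mkℚ; ½; 1ℚ)
import Data.Rational.Properties as ℚP
import Data.Nat.Coprimality as Coprime
open import Data.Rational.Solver using () renaming (module +-*-Solver to ℚ-Solver)
module ℚ* = Algebra.Properties.CommutativeSemigroup (CommutativeMonoid.commutativeSemigroup ℚP.*-1-commutativeMonoid)

∑ : {A : Set} → List A → (A → ℕ) → ℕ
∑ xs f = sum (map f xs)

syntax ∑ xs (λ x → e) = ∑[ x ∈ xs ] e

∑-cong : {A : Set} (xs : List A) {f g : A → ℕ} → (∀ x → f x ≡ g x) → ∑ xs f ≡ ∑ xs g
∑-cong xs f≗g = cong sum (map-cong f≗g xs)

∑-zero : {A : Set} (xs : List A) → ∑[ x ∈ xs ] 0 ≡ 0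
∑-zero []       = refl
∑-zero (x ∷ xs) = ∑-zero xs

∑-+ : {A : Set} (xs : List A) (f g : A → ℕ) → ∑[ x ∈ xs ] (f x + g x) ≡ ∑ xs f + ∑ xs g
∑-+ []       f g = refl
∑-+ (x ∷ xs) f g =
  trans (cong (f x + g x +_) (∑-+ xs f g)) (interchange (f x) (g x) (∑ xs f) (∑ xs g))

∑-swap : {A B : Set} (xs : List A) (ys : List B) (f : A → B → ℕ) →
         ∑[ x ∈ xs ] ∑[ y ∈ ys ] f x y ≡ ∑[ y ∈ ys ] ∑[ x ∈ xs ] f x y
∑-swap []       ys f = sym (∑-zero ys)
∑-swap (x ∷ xs) ys f =
  trans (cong (∑ ys (f x) +_) (∑-swap xs ys f)) (sym (∑-+ ys (f x) λ y → ∑[ x ∈ xs ] f x y))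

bits : List Bool
bits = false ∷ true ∷ []

∑-cube : ∀ n (g : Cube (suc n) → ℕ) →
         ∑ (allCube (suc n)) g ≡ ∑[ v ∈ allCube n ] ∑[ b ∈ bits ] g (b ∷ v)
∑-cube n g = split (allCube n)
  where
  split : (vs : List (Cube n)) →
          ∑ (concatMap (λ v → (false ∷ v) ∷ (true ∷ v) ∷ []) vs) g ≡ ∑[ v ∈ vs ] ∑[ b ∈ bits ] g (b ∷ v)
  split []       = refl
  split (v ∷ vs) = trans (cong (λ r → g (false ∷ v) + (g (true ∷ v) + r)) (split vs))
    (solve 3 (λ p q r → p :+ (q :+ r) := (p :+ (q :+ con 0)) :+ r) refl (g (false ∷ v)) (g (true ∷ v)) _)

δ : Bool → Bool → ℕ
δ false false = 0
δ false true  = 1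
δ true  false = 1
δ true  true  = 0

ham-∷ : ∀ {n} b c (x y : Cube n) → ham (b ∷ x) (c ∷ y) ≡ δ b c + ham x y
ham-∷ false false x y = refl
ham-∷ false true  x y = refl
ham-∷ true  false x y = refl
ham-∷ true  true  x y = refl

-- A kernel is a function of the two distances d(x,u), d(y,u).
Kernel : Set
Kernel = ℕ → ℕ → ℕ

triple : ℕ → Kernel → ℕ
triple n F = ∑[ x ∈ allCube n ] ∑[ y ∈ allCube n ] ∑[ u ∈ allCube n ] F (ham x u) (ham y u)

-- Φ F a b sums F over the bits s, t, r of one extra coordinate of x, y, u,
-- which raise the two distances a, b by δ s r and δ t r.
Φ : Kernel → Kernel
Φ F a b = ∑[ s ∈ bits ] ∑[ t ∈ bits ] ∑[ r ∈ bits ] F (δ s r + a) (δ t r + b)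

Φ^ : ℕ → Kernel → Kernel
Φ^ zero    F = F
Φ^ (suc n) F = Φ^ n (Φ F)

triple-suc : ∀ n F → triple (suc n) F ≡ triple n (Φ F)
triple-suc n F = begin
    triple (suc n) F
  ≡⟨ peel ⟩
    (∑[ x ∈ Q ] ∑[ s ∈ bits ] ∑[ y ∈ Q ] ∑[ t ∈ bits ] ∑[ u ∈ Q ] ∑[ r ∈ bits ] G x y u s t r)
  ≡⟨ ∑-cong Q (λ x → ∑-swap bits Q λ s y → ∑[ t ∈ bits ] ∑[ u ∈ Q ] ∑[ r ∈ bits ] G x y u s t r) ⟩
    (∑[ x ∈ Q ] ∑[ y ∈ Q ] ∑[ s ∈ bits ] ∑[ t ∈ bits ] ∑[ u ∈ Q ] ∑[ r ∈ bits ] G x y u s t r)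
  ≡⟨ ∑-cong Q (λ x → ∑-cong Q λ y → ∑-cong bits λ s →
       ∑-swap bits Q λ t u → ∑[ r ∈ bits ] G x y u s t r) ⟩
    (∑[ x ∈ Q ] ∑[ y ∈ Q ] ∑[ s ∈ bits ] ∑[ u ∈ Q ] ∑[ t ∈ bits ] ∑[ r ∈ bits ] G x y u s t r)
  ≡⟨ ∑-cong Q (λ x → ∑-cong Q λ y →
       ∑-swap bits Q λ s u → ∑[ t ∈ bits ] ∑[ r ∈ bits ] G x y u s t r) ⟩
    triple n (Φ F)
  ∎
  where
  open ≡-Reasoning
  Q = allCube n
  Q′ = allCube (suc n)
  G : Cube n → Cube n → Cube n → Bool → Bool → Bool → ℕ
  G x y u s t r = F (δ s r + ham x u) (δ t r + ham y u)
  peel : triple (suc n) F ≡ ∑[ x ∈ Q ] ∑[ s ∈ bits ] ∑[ y ∈ Q ] ∑[ t ∈ bits ] ∑[ u ∈ Q ] ∑[ r ∈ bits ] G x y u s t r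
  peel =
    trans (∑-cube n λ x′ → ∑[ y′ ∈ Q′ ] ∑[ u′ ∈ Q′ ] F (ham x′ u′) (ham y′ u′)) (∑-cong Q λ x → ∑-cong bits λ s →
    trans (∑-cube n λ y′ → ∑[ u′ ∈ Q′ ] F (ham (s ∷ x) u′) (ham y′ u′)) (∑-cong Q λ y → ∑-cong bits λ t →
    trans (∑-cube n λ u′ → F (ham (s ∷ x) u′) (ham (t ∷ y) u′)) (∑-cong Q λ u → ∑-cong bits λ r →
    cong₂ F (ham-∷ s r x u) (ham-∷ t r y u))))

triple≡Φ^ : ∀ n F → triple n F ≡ Φ^ n F 0 0
triple≡Φ^ zero    F = trans (+-identityʳ _) (trans (+-identityʳ _) (+-identityʳ _))
triple≡Φ^ (suc n) F = trans (triple-suc n F) (triple≡Φ^ n (Φ F))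

infix  4 _≐_
infixl 6 _⊕_

_≐_ : Kernel → Kernel → Set
F ≐ G = ∀ a b → F a b ≡ G a b

_⊕_ : Kernel → Kernel → Kernel
(F ⊕ G) a b = F a b + G a b

Φ^-step : ∀ n F → Φ^ (suc n) F ≐ Φ (Φ^ n F)
Φ^-step zero    F a b = refl
Φ^-step (suc n) F a b = Φ^-step n (Φ F) a b

Φ-cong : ∀ {F G} → F ≐ G → Φ F ≐ Φ G
Φ-cong F≐G a b = ∑-cong bits λ s → ∑-cong bits λ t → ∑-cong bits λ r → F≐G (δ s r + a) (δ t r + b)

Φ^-cong : ∀ n {F G} → F ≐ G → Φ^ n F ≐ Φ^ n G
Φ^-cong zero    F≐G = F≐G
Φ^-cong (suc n) F≐G = Φ^-cong n (Φ-cong F≐G)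

Φ-⊕ : ∀ F G → Φ (F ⊕ G) ≐ Φ F ⊕ Φ G
Φ-⊕ F G a b =
  trans (∑-cong bits λ s → trans (∑-cong bits λ t → ∑-+ bits (f s t) (g s t))
                                 (∑-+ bits (λ t → ∑ bits (f s t)) (λ t → ∑ bits (g s t))))
        (∑-+ bits (λ s → ∑[ t ∈ bits ] ∑ bits (f s t)) (λ s → ∑[ t ∈ bits ] ∑ bits (g s t)))
  where
  f g : Bool → Bool → Bool → ℕ
  f s t r = F (δ s r + a) (δ t r + b)
  g s t r = G (δ s r + a) (δ t r + b)

Φ^-⊕ : ∀ n F G → Φ^ n (F ⊕ G) ≐ Φ^ n F ⊕ Φ^ n G
Φ^-⊕ zero    F G a b = refl
Φ^-⊕ (suc n) F G a b = trans (Φ^-cong n (Φ-⊕ F G) a b) (Φ^-⊕ n (Φ F) (Φ G) a b)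

-- Φ moves each argument by translation only, so it commutes with shifting an argument.
Φ^-shiftˡ : ∀ n F a b → Φ^ n (λ a b → F (suc a) b) a b ≡ Φ^ n F (suc a) b
Φ^-shiftˡ zero    F a b = refl
Φ^-shiftˡ (suc n) F a b = Φ^-shiftˡ n (Φ F) a b

Φ^-shiftʳ : ∀ n F a b → Φ^ n (λ a b → F a (suc b)) a b ≡ Φ^ n F a (suc b)
Φ^-shiftʳ zero    F a b = refl
Φ^-shiftʳ (suc n) F a b = Φ^-shiftʳ n (Φ F) a b

Symmetric : Kernel → Set
Symmetric F = ∀ a b → F a b ≡ F b a

DiagInvariant : Kernel → Set
DiagInvariant F = ∀ a b → F (suc a) (suc b) ≡ F a b

Φ^-preserves : (P : Kernel → Set) → (∀ {F} → P F → P (Φ F)) → ∀ n {F} → P F → P (Φ^ n F)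
Φ^-preserves P pres zero    pF = pF
Φ^-preserves P pres (suc n) pF = Φ^-preserves P pres n (pres pF)

Φ-symmetric : ∀ {F} → Symmetric F → Symmetric (Φ F)
Φ-symmetric {F} sym-F a b =
  trans (∑-cong bits λ s → ∑-cong bits λ t → ∑-cong bits λ r → sym-F (δ s r + a) (δ t r + b))
        (∑-swap bits bits λ s t → ∑[ r ∈ bits ] F (δ t r + b) (δ s r + a))

Φ-diagInvariant : ∀ {F} → DiagInvariant F → DiagInvariant (Φ F)
Φ-diagInvariant {F} inv-F a b = ∑-cong bits λ s → ∑-cong bits λ t → ∑-cong bits λ r →
  trans (cong₂ F (+-suc (δ s r) a) (+-suc (δ t r) b)) (inv-F (δ s r + a) (δ t r + b))

-- Written out, the eight terms of Φ F pair up: each of the four shifts of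
-- (a, b) by (0|1, 0|1) occurs twice.
Φ-expand : ∀ F a b → Φ F a b ≡ 2 * (F a b + F (suc a) (suc b) + (F a (suc b) + F (suc a) b))
Φ-expand F a b = solve 4
  (λ p q u v → ((p :+ (q :+ con 0)) :+ ((u :+ (v :+ con 0)) :+ con 0))
                 :+ (((v :+ (u :+ con 0)) :+ ((q :+ (p :+ con 0)) :+ con 0)) :+ con 0)
               := con 2 :* (p :+ q :+ (u :+ v)))
  refl (F a b) (F (suc a) (suc b)) (F a (suc b)) (F (suc a) b)

Φ-diag : ∀ {F} → DiagInvariant F → ∀ a b → Φ F a b ≡ 2 * (2 * F a b + (F a (suc b) + F (suc a) b))
Φ-diag {F} inv-F a b = begin
    Φ F a b
  ≡⟨ Φ-expand F a b ⟩
    2 * (F a b + F (suc a) (suc b) + w)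
  ≡⟨ cong (λ q → 2 * (F a b + q + w)) (inv-F a b) ⟩
    2 * (F a b + F a b + w)
  ≡⟨ cong (λ z → 2 * (F a b + z + w)) (sym (+-identityʳ (F a b))) ⟩
    2 * (2 * F a b + w)
  ∎
  where
  open ≡-Reasoning
  w = F a (suc b) + F (suc a) b

Φ^-diag-step : ∀ n {F} → DiagInvariant F → ∀ a b →
  Φ^ (suc n) F a b ≡ 2 * (2 * Φ^ n F a b + (Φ^ n F a (suc b) + Φ^ n F (suc a) b))
Φ^-diag-step n {F} inv-F a b =
  trans (Φ^-step n F a b) (Φ-diag (Φ^-preserves DiagInvariant Φ-diagInvariant n inv-F) a b)

equal : Kernel
equal zero    zero    = 1
equal zero    (suc b) = 0
equal (suc a) zero    = 0
equal (suc a) (suc b) = equal a b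

equal-symmetric : Symmetric equal
equal-symmetric zero    zero    = refl
equal-symmetric zero    (suc b) = refl
equal-symmetric (suc a) zero    = refl
equal-symmetric (suc a) (suc b) = equal-symmetric a b

-- Moving one argument of |a - b| by one changes it by ±1, except on the
-- diagonal: |a - (b+1)| + |(a+1) - b| = 2 |a - b| + 2 [a = b].
absDiff-step : ∀ a b → absDiff a (suc b) + absDiff (suc a) b ≡ (absDiff a b + equal a b) + (absDiff a b + equal a b)
absDiff-step zero    zero    = refl
absDiff-step zero    (suc b) = trans (cong (λ z → suc (suc b) + (z + b)) (0∸n≡0 b))
  (solve 1 (λ b → (con 2 :+ b) :+ (con 0 :+ b) := ((con 1 :+ b) :+ con 0) :+ ((con 1 :+ b) :+ con 0)) refl b)
absDiff-step (suc a) zero    = trans (cong (λ z → (a + z) + (suc (suc a) + 0)) (0∸n≡0 a))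
  (solve 1 (λ a → (a :+ con 0) :+ ((con 2 :+ a) :+ con 0)
              := (((con 1 :+ a) :+ con 0) :+ con 0) :+ (((con 1 :+ a) :+ con 0) :+ con 0)) refl a)
absDiff-step (suc a) (suc b) = absDiff-step a b

pascal : ∀ m k → suc m C suc k ≡ m C k + m C suc k
pascal m k = sym (nCk+nC[k+1]≡[n+1]C[k+1] m k)

pascal² : ∀ N m → suc (suc N) C suc (suc m) ≡ N C m + 2 * (N C suc m) + N C suc (suc m)
pascal² N m = begin
    suc (suc N) C suc (suc m)
  ≡⟨ pascal (suc N) (suc m) ⟩
    suc N C suc m + suc N C suc (suc m)
  ≡⟨ cong₂ _+_ (pascal N m) (pascal N (suc m)) ⟩
    (N C m + N C suc m) + (N C suc m + N C suc (suc m))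
  ≡⟨ solve 3 (λ x y z → (x :+ y) :+ (y :+ z) := x :+ con 2 :* y :+ z) refl (N C m) (N C suc m) (N C suc (suc m)) ⟩
    N C m + 2 * (N C suc m) + N C suc (suc m)
  ∎
  where open ≡-Reasoning

-- The central coefficient: C(2n+2, n+1) = 2 C(2n,n) + 2 C(2n,n+1),
-- by Pascal's rule and the symmetry C(2n+1, n) = C(2n+1, n+1).
central : ∀ n → suc (suc (n + n)) C suc n ≡ 2 * ((n + n) C n) + 2 * ((n + n) C suc n)
central n = begin
    suc (suc N) C suc n
  ≡⟨ pascal (suc N) n ⟩
    suc N C n + suc N C suc n
  ≡⟨ cong (_+ suc N C suc n) mirror ⟩
    suc N C suc n + suc N C suc n
  ≡⟨ cong (λ t → t + t) (pascal N n) ⟩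
    (N C n + N C suc n) + (N C n + N C suc n)
  ≡⟨ solve 2 (λ x y → (x :+ y) :+ (x :+ y) := con 2 :* x :+ con 2 :* y) refl (N C n) (N C suc n) ⟩
    2 * (N C n) + 2 * (N C suc n)
  ∎
  where
  open ≡-Reasoning
  N = n + n
  mirror : suc N C n ≡ suc N C suc n
  mirror = trans (nCk≡nC[n∸k] (≤-trans (m≤m+n n n) (n≤1+n N))) (cong (suc N C_) (m+n∸n≡m (suc n) n))

absorption : ∀ m k → suc k * (m C suc k) + k * (m C k) ≡ m * (m C k)
absorption zero    zero    = refl
absorption zero    (suc k) rewrite k>n⇒nCk≡0 {0} {suc k} (s≤s z≤n) | *-zeroʳ k = refl
absorption (suc m) zero    = trans (+-identityʳ _) (trans (+-identityʳ _) (trans (nC1≡n (suc m)) (sym (*-identityʳ (suc m)))))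
absorption (suc m) (suc j) = begin
    suc (suc j) * (suc m C suc (suc j)) + suc j * (suc m C suc j)
  ≡⟨ cong₂ (λ p q → suc (suc j) * p + suc j * q) (pascal m (suc j)) (pascal m j) ⟩
    suc (suc j) * (y + z) + suc j * (x + y)
  ≡⟨ solve 4 (λ j x y z → (con 2 :+ j) :* (y :+ z) :+ (con 1 :+ j) :* (x :+ y)
          := (((con 2 :+ j) :* z :+ (con 1 :+ j) :* y) :+ ((con 1 :+ j) :* y :+ j :* x)) :+ (y :+ x)) refl j x y z ⟩
    ((suc (suc j) * z + suc j * y) + (suc j * y + j * x)) + (y + x)
  ≡⟨ cong₂ (λ p q → (p + q) + (y + x)) (absorption m (suc j)) (absorption m j) ⟩
    (m * y + m * x) + (y + x)
  ≡⟨ solve 3 (λ m x y → (m :* y :+ m :* x) :+ (y :+ x) := (con 1 :+ m) :* (x :+ y)) refl m x y ⟩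
    suc m * (x + y)
  ≡⟨ cong (suc m *_) (sym (pascal m j)) ⟩
    suc m * (suc m C suc j)
  ∎
  where
  open ≡-Reasoning
  x = m C j
  y = m C suc j
  z = m C suc (suc j)

central-ratio : ∀ n → suc n * ((n + n) C suc n) ≡ n * ((n + n) C n)
central-ratio n = +-cancelʳ-≡ (n * c) (suc n * (N C suc n)) (n * c)
  (trans (absorption N n) (*-distribʳ-+ c n n))
  where
  N = n + n
  c = N C n

suc-double : ∀ n → suc n + suc n ≡ suc (suc (n + n))
suc-double n = cong suc (+-suc n n)

-- E n a b = ∑_{x,y,u} [d(x,u)+a = d(y,u)+b]: the shifted coincidence counts.
E : ℕ → Kernel
E n = Φ^ n equal

E-formula : ∀ n k → E n k 0 ≡ 2 ^ n * ((n + n) C (k + n))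
E-formula zero    zero    = refl
E-formula zero    (suc k) = sym (trans (+-identityʳ (0 C suc (k + 0))) (k>n⇒nCk≡0 (s≤s (z≤n {k + 0}))))
E-formula (suc n) zero    = begin
    E (suc n) 0 0
  ≡⟨ Φ^-diag-step n (λ _ _ → refl) 0 0 ⟩
    2 * (2 * E n 0 0 + (E n 0 1 + E n 1 0))
  ≡⟨ cong (λ e → 2 * (2 * E n 0 0 + (e + E n 1 0)))
          (Φ^-preserves Symmetric Φ-symmetric n equal-symmetric 0 1) ⟩
    2 * (2 * E n 0 0 + (E n 1 0 + E n 1 0))
  ≡⟨ cong₂ (λ p q → 2 * (2 * p + (q + q))) (E-formula n 0) (E-formula n 1) ⟩
    2 * (2 * (P * (N C n)) + (P * (N C suc n) + P * (N C suc n)))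
  ≡⟨ solve 3 (λ P x y → con 2 :* (con 2 :* (P :* x) :+ (P :* y :+ P :* y))
                      := con 2 :* P :* (con 2 :* x :+ con 2 :* y)) refl P (N C n) (N C suc n) ⟩
    2 * P * (2 * (N C n) + 2 * (N C suc n))
  ≡⟨ cong (2 * P *_) (sym (central n)) ⟩
    2 * P * (suc (suc N) C suc n)
  ≡⟨ cong (λ M → 2 * P * (M C suc n)) (sym (suc-double n)) ⟩
    2 ^ suc n * ((suc n + suc n) C suc n)
  ∎
  where
  open ≡-Reasoning
  N = n + n
  P = 2 ^ n
E-formula (suc n) (suc j) = begin
    E (suc n) (suc j) 0
  ≡⟨ Φ^-diag-step n (λ _ _ → refl) (suc j) 0 ⟩
    2 * (2 * E n (suc j) 0 + (E n (suc j) 1 + E n (suc (suc j)) 0))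
  ≡⟨ cong (λ e → 2 * (2 * E n (suc j) 0 + (e + E n (suc (suc j)) 0)))
          (Φ^-preserves DiagInvariant Φ-diagInvariant n (λ _ _ → refl) j 0) ⟩
    2 * (2 * E n (suc j) 0 + (E n j 0 + E n (suc (suc j)) 0))
  ≡⟨ cong₂ (λ p q → 2 * (2 * p + q)) (E-formula n (suc j))
           (cong₂ _+_ (E-formula n j) (E-formula n (suc (suc j)))) ⟩
    2 * (2 * (P * (N C suc m)) + (P * (N C m) + P * (N C suc (suc m))))
  ≡⟨ solve 4 (λ P x y z → con 2 :* (con 2 :* (P :* y) :+ (P :* x :+ P :* z))
                        := con 2 :* P :* (x :+ con 2 :* y :+ z)) refl P (N C m) (N C suc m) (N C suc (suc m)) ⟩
    2 * P * (N C m + 2 * (N C suc m) + N C suc (suc m))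
  ≡⟨ cong (2 * P *_) (sym (pascal² N m)) ⟩
    2 * P * (suc (suc N) C suc (suc m))
  ≡⟨ cong₂ (λ M i → 2 * P * (M C i)) (sym (suc-double n)) (sym (+-suc (suc j) n)) ⟩
    2 ^ suc n * ((suc n + suc n) C (suc j + suc n))
  ∎
  where
  open ≡-Reasoning
  N = n + n
  P = 2 ^ n
  m = j + n

-- A n a b = ∑_{x,y,u} |(d(x,u)+a) - (d(y,u)+b)|.
A : ℕ → Kernel
A n = Φ^ n absDiff

A-neighbours : ∀ n → A n 0 1 + A n 1 0 ≡ (A n 0 0 + E n 0 0) + (A n 0 0 + E n 0 0)
A-neighbours n = begin
    A n 0 1 + A n 1 0
  ≡⟨ sym (cong₂ _+_ (Φ^-shiftʳ n absDiff 0 0) (Φ^-shiftˡ n absDiff 0 0)) ⟩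
    Φ^ n (λ a b → absDiff a (suc b)) 0 0 + Φ^ n (λ a b → absDiff (suc a) b) 0 0
  ≡⟨ sym (Φ^-⊕ n (λ a b → absDiff a (suc b)) (λ a b → absDiff (suc a) b) 0 0) ⟩
    Φ^ n (λ a b → absDiff a (suc b) + absDiff (suc a) b) 0 0
  ≡⟨ Φ^-cong n {G = D ⊕ D} absDiff-step 0 0 ⟩
    Φ^ n (D ⊕ D) 0 0
  ≡⟨ Φ^-⊕ n D D 0 0 ⟩
    Φ^ n D 0 0 + Φ^ n D 0 0
  ≡⟨ cong (λ t → t + t) (Φ^-⊕ n absDiff equal 0 0) ⟩
    (A n 0 0 + E n 0 0) + (A n 0 0 + E n 0 0)
  ∎
  where
  open ≡-Reasoning
  D = absDiff ⊕ equal

A-step : ∀ n → A (suc n) 0 0 ≡ 8 * A n 0 0 + 4 * E n 0 0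
A-step n = begin
    A (suc n) 0 0
  ≡⟨ Φ^-diag-step n (λ _ _ → refl) 0 0 ⟩
    2 * (2 * A n 0 0 + (A n 0 1 + A n 1 0))
  ≡⟨ cong (λ t → 2 * (2 * A n 0 0 + t)) (A-neighbours n) ⟩
    2 * (2 * A n 0 0 + ((A n 0 0 + E n 0 0) + (A n 0 0 + E n 0 0)))
  ≡⟨ solve 2 (λ a e → con 2 :* (con 2 :* a :+ ((a :+ e) :+ (a :+ e))) := con 8 :* a :+ con 4 :* e)
       refl (A n 0 0) (E n 0 0) ⟩
    8 * A n 0 0 + 4 * E n 0 0
  ∎
  where open ≡-Reasoning

A-formula : ∀ n → A n 0 0 ≡ n * 2 ^ n * ((n + n) C n)
A-formula zero    = refl
A-formula (suc n) = begin
    A (suc n) 0 0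
  ≡⟨ A-step n ⟩
    8 * A n 0 0 + 4 * E n 0 0
  ≡⟨ cong₂ (λ p q → 8 * p + 4 * q) (A-formula n) (E-formula n 0) ⟩
    8 * (n * P * c) + 4 * (P * c)
  ≡⟨ solve 3 (λ n P c → con 8 :* (n :* P :* c) :+ con 4 :* (P :* c)
                      := con 4 :* P :* ((con 1 :+ n) :* c :+ n :* c)) refl n P c ⟩
    4 * P * (suc n * c + n * c)
  ≡⟨ cong (λ t → 4 * P * (suc n * c + t)) (sym (central-ratio n)) ⟩
    4 * P * (suc n * c + suc n * d)
  ≡⟨ solve 4 (λ n P c d → con 4 :* P :* ((con 1 :+ n) :* c :+ (con 1 :+ n) :* d)
                        := (con 1 :+ n) :* (con 2 :* P) :* (con 2 :* c :+ con 2 :* d)) refl n P c d ⟩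
    suc n * (2 * P) * (2 * c + 2 * d)
  ≡⟨ cong (suc n * (2 * P) *_) (sym (central n)) ⟩
    suc n * (2 * P) * (suc (suc N) C suc n)
  ≡⟨ cong (λ M → suc n * (2 * P) * (M C suc n)) (sym (suc-double n)) ⟩
    suc n * 2 ^ suc n * ((suc n + suc n) C suc n)
  ∎
  where
  open ≡-Reasoning
  N = n + n
  P = 2 ^ n
  c = N C n
  d = N C suc n

triple-absDiff : ∀ n → triple n absDiff ≡ n * 2 ^ n * ((n + n) C n)
triple-absDiff n = trans (triple≡Φ^ n absDiff) (A-formula n)

natℚ-mkℚ : ∀ k → natℚ k ≡ mkℚ (ℤ.+ k) 0 (Coprime.sym (Coprime.1-coprimeTo k))
natℚ-mkℚ k = ℚP.normalize-coprime (Coprime.sym (Coprime.1-coprimeTo k))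

natℚ-+ : ∀ a b → natℚ (a + b) ≡ natℚ a ℚ.+ natℚ b
natℚ-+ a b rewrite natℚ-mkℚ a | natℚ-mkℚ b =
  ℚP./-cong {ℤ.+ (a + b)} (sym (cong₂ ℤ._+_ (ℤP.*-identityʳ (ℤ.+ a)) (ℤP.*-identityʳ (ℤ.+ b)))) refl

natℚ-* : ∀ a b → natℚ (a * b) ≡ natℚ a ℚ.* natℚ b
natℚ-* a b rewrite natℚ-mkℚ a | natℚ-mkℚ b = ℚP./-cong {ℤ.+ (a * b)} (ℤP.pos-* a b) refl

sumℚ-++ : ∀ ps qs → sumℚ (ps ++ qs) ≡ sumℚ ps ℚ.+ sumℚ qs
sumℚ-++ []       qs = sym (ℚP.+-identityˡ (sumℚ qs))
sumℚ-++ (p ∷ ps) qs = trans (cong (p ℚ.+_) (sumℚ-++ ps qs)) (sym (ℚP.+-assoc p (sumℚ ps) (sumℚ qs)))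

sumℚ-concatMap : {A : Set} (f : A → List ℚ) (xs : List A) →
                 sumℚ (concatMap f xs) ≡ sumℚ (map (λ x → sumℚ (f x)) xs)
sumℚ-concatMap f []       = refl
sumℚ-concatMap f (x ∷ xs) = trans (sumℚ-++ (f x) (concatMap f xs)) (cong (sumℚ (f x) ℚ.+_) (sumℚ-concatMap f xs))

sumℚ-natℚ : {A : Set} (q : ℚ) (g : A → ℕ) (xs : List A) →
            sumℚ (map (λ x → q ℚ.* natℚ (g x)) xs) ≡ q ℚ.* natℚ (∑ xs g)
sumℚ-natℚ q g []       = sym (ℚP.*-zeroʳ q)
sumℚ-natℚ q g (x ∷ xs) = begin
    q ℚ.* natℚ (g x) ℚ.+ sumℚ (map (λ x → q ℚ.* natℚ (g x)) xs)
  ≡⟨ cong (q ℚ.* natℚ (g x) ℚ.+_) (sumℚ-natℚ q g xs) ⟩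
    q ℚ.* natℚ (g x) ℚ.+ q ℚ.* natℚ (∑ xs g)
  ≡⟨ sym (ℚP.*-distribˡ-+ q (natℚ (g x)) (natℚ (∑ xs g))) ⟩
    q ℚ.* (natℚ (g x) ℚ.+ natℚ (∑ xs g))
  ≡⟨ cong (q ℚ.*_) (sym (natℚ-+ (g x) (∑ xs g))) ⟩
    q ℚ.* natℚ (g x + ∑ xs g)
  ∎
  where open ≡-Reasoning

sum-of-lam : ∀ n → sumℚ (concatMap (λ x → map (λ y → lam x y) (allCube n)) (allCube n))
                   ≡ ½ ℚ.* natℚ (triple n absDiff)
sum-of-lam n = begin
    sumℚ (concatMap (λ x → map (λ y → lam x y) Q) Q)
  ≡⟨ sumℚ-concatMap (λ x → map (λ y → lam x y) Q) Q ⟩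
    sumℚ (map (λ x → sumℚ (map (λ y → ½ ℚ.* natℚ (inner x y)) Q)) Q)
  ≡⟨ cong sumℚ (map-cong (λ x → sumℚ-natℚ ½ (inner x) Q) Q) ⟩
    sumℚ (map (λ x → ½ ℚ.* natℚ (∑ Q (inner x))) Q)
  ≡⟨ sumℚ-natℚ ½ (λ x → ∑ Q (inner x)) Q ⟩
    ½ ℚ.* natℚ (triple n absDiff)
  ∎
  where
  open ≡-Reasoning
  Q = allCube n
  inner : Cube n → Cube n → ℕ
  inner x y = ∑[ u ∈ Q ] absDiff (ham x u) (ham y u)

half^-+ : ∀ a b → half^ (a + b) ≡ half^ a ℚ.* half^ b
half^-+ zero    b = sym (ℚP.*-identityˡ (half^ b))
half^-+ (suc a) b = trans (cong (½ ℚ.*_) (half^-+ a b)) (sym (ℚP.*-assoc ½ (half^ a) (half^ b)))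

half^-2^ : ∀ n → half^ n ℚ.* natℚ (2 ^ n) ≡ 1ℚ
half^-2^ zero    = refl
half^-2^ (suc n) = begin
    (½ ℚ.* half^ n) ℚ.* natℚ (2 * 2 ^ n)
  ≡⟨ cong ((½ ℚ.* half^ n) ℚ.*_) (natℚ-* 2 (2 ^ n)) ⟩
    (½ ℚ.* half^ n) ℚ.* (natℚ 2 ℚ.* natℚ (2 ^ n))
  ≡⟨ ℚ*.interchange ½ (half^ n) (natℚ 2) (natℚ (2 ^ n)) ⟩
    (½ ℚ.* natℚ 2) ℚ.* (half^ n ℚ.* natℚ (2 ^ n))
  ≡⟨ cong ((½ ℚ.* natℚ 2) ℚ.*_) (half^-2^ n) ⟩
    (½ ℚ.* natℚ 2) ℚ.* 1ℚ
  ≡⟨⟩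
    1ℚ
  ∎
  where open ≡-Reasoning

regroup : ∀ o h m p c → (h ℚ.* h) ℚ.* (o ℚ.* ((m ℚ.* p) ℚ.* c)) ≡ (h ℚ.* p) ℚ.* ((m ℚ.* (o ℚ.* h)) ℚ.* c)
regroup = ℚ-solve 5 (λ o h m p c → (h ⊛ h) ⊛ (o ⊛ ((m ⊛ p) ⊛ c)) ⊜ (h ⊛ p) ⊛ ((m ⊛ (o ⊛ h)) ⊛ c)) refl
  where open ℚ-Solver using () renaming (solve to ℚ-solve; _:*_ to _⊛_; _:=_ to _⊜_)

-- The average of λ is Λ n = n 2^-(n+1) C(2n,n): multiply half the triple sum by 2^-2n.
-- The identity holds for every n (both sides vanish at n = 0).
proposition3p2 : (n : ℕ) → n ≥ 1 → avgLam n ≡ Λ n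
proposition3p2 n _ = begin
    avgLam n
  ≡⟨ cong (half^ (n + n) ℚ.*_) (sum-of-lam n) ⟩
    half^ (n + n) ℚ.* (½ ℚ.* natℚ (triple n absDiff))
  ≡⟨ cong (λ t → half^ (n + n) ℚ.* (½ ℚ.* natℚ t)) (triple-absDiff n) ⟩
    half^ (n + n) ℚ.* (½ ℚ.* natℚ (n * 2 ^ n * c))
  ≡⟨ cong₂ (λ h t → h ℚ.* (½ ℚ.* t)) (half^-+ n n)
           (trans (natℚ-* (n * 2 ^ n) c) (cong (ℚ._* natℚ c) (natℚ-* n (2 ^ n)))) ⟩
    (h ℚ.* h) ℚ.* (½ ℚ.* ((natℚ n ℚ.* natℚ (2 ^ n)) ℚ.* natℚ c))
  ≡⟨ regroup ½ h (natℚ n) (natℚ (2 ^ n)) (natℚ c) ⟩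
    (h ℚ.* natℚ (2 ^ n)) ℚ.* Λ n
  ≡⟨ cong (ℚ._* Λ n) (half^-2^ n) ⟩
    1ℚ ℚ.* Λ n
  ≡⟨ ℚP.*-identityˡ (Λ n) ⟩
    Λ n
  ∎
  where
  open ≡-Reasoning
  h = half^ n
  c = (n + n) C n
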